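{- Define, for non-negative integers $i,j$, $MC(i,j) = \frac{(j-i)(-1)^{i+j}}{(i+1)(j+1)\binom{i+j+2}{i+1}}$. Then for all non-negative integers $i,j$, $MC(i+1,j)+MC(i,j+1) = -MC(i,j)$. -}

module Defs where

open import Data.Nat as ℕ using (ℕ; zero; suc; NonZero; _≤_; z≤n; s≤s)
open import Data.Nat.Properties using (m*n≢0; +-suc)
open import Data.Integer as ℤ using (ℤ; +_)
open import Data.Rational using (ℚ; _/_)

open import Data.Nat.Combinatorics using (_C_; nCk+nC[k+1]≡[n+1]C[k+1])
open import Relation.Binary.PropositionalEquality using (subst; sym)

C≢0 : ∀ n k → k ≤ n → NonZero (n C k)
C≢0 n zero _ = _
C≢0 (suc n) (suc k) (s≤s k≤n) =
  subst NonZero (nCk+nC[k+1]≡[n+1]C[k+1] n k) (help (n C k) (C≢0 n k k≤n))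
  where
  help : ∀ a {b} → NonZero a → NonZero (a ℕ.+ b)
  help (suc a) _ = _

le : ∀ i j → suc i ≤ i ℕ.+ j ℕ.+ 2
le zero j = subst (1 ≤_) (sym (+-suc j 1)) (s≤s z≤n)
le (suc i) j = s≤s (le i j)

den : ℕ → ℕ → ℕ
den i j = suc i ℕ.* suc j ℕ.* ((i ℕ.+ j ℕ.+ 2) C suc i)

den≢0 : ∀ i j → NonZero (den i j)
den≢0 i j = m*n≢0 (suc i ℕ.* suc j) _ {{m*n≢0 (suc i) (suc j)}} {{C≢0 _ _ (le i j)}}

sgn : ℕ → ℤ
sgn zero = + 1
sgn (suc n) = ℤ.- sgn n

MC : ℕ → ℕ → ℚ
MC i j = ((+ j ℤ.- + i) ℤ.* sgn (i ℕ.+ j) / den i j) {{den≢0 i j}}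

-- Write n = i + j + 2.  The absorption identity (k+1)·C(n+1, k+1) = (n+1)·C(n, k)
-- and the symmetry C(n, i+1) = C(n, j+1) give
--   (i+1)·den (i+1) j = (n+1)·den i j = (j+1)·den i (j+1),
-- so over the common denominator (n+1)·den i j the claim reduces to the
-- polynomial identity (j−i−1)(i+1) + (j−i+1)(j+1) = (j−i)(n+1).
module Submission where

open import Defs
open import Data.Nat as ℕ using (ℕ; zero; suc; NonZero)
open import Data.Nat.Properties using (+-assoc; +-comm; +-suc; *-comm; *-zeroʳ; *-identityˡ; *-identityʳ; m≤m+n; m+n∸m≡n)
open import Data.Nat.Combinatorics using (_C_; nCk+nC[k+1]≡[n+1]C[k+1]; nCk≡nC[n∸k]; nC1≡n)
import Data.Nat.Tactic.RingSolver as ℕ-Solver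
open import Data.Integer as ℤ using (ℤ; +_)
import Data.Integer.Properties as ℤ
import Data.Integer.Tactic.RingSolver as ℤ-Solver
open import Data.List using (_∷_; [])
open import Data.Rational using (_/_; _+_; -_; toℚᵘ)
open import Data.Rational.Properties using (toℚᵘ-fromℚᵘ; toℚᵘ-injective; toℚᵘ-homo-+; toℚᵘ-homo‿-)
open import Data.Rational.Unnormalised as ℚᵘ using (mkℚᵘ; *≡*; _≃_)
open import Data.Rational.Unnormalised.Properties using (≃-trans; ≃-sym; +-cong; -‿cong; module ≃-Reasoning)
open import Relation.Binary.PropositionalEquality using (_≡_; sym; trans; cong; cong₂; module ≡-Reasoning)

[1+k]*[1+n]C[1+k]≡[1+n]*nCk : ∀ n k → suc k ℕ.* (suc n C suc k) ≡ suc n ℕ.* (n C k)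
[1+k]*[1+n]C[1+k]≡[1+n]*nCk n zero = trans (*-identityˡ _) (trans (nC1≡n (suc n)) (sym (*-identityʳ _)))
[1+k]*[1+n]C[1+k]≡[1+n]*nCk zero (suc k) = *-zeroʳ (suc (suc k))
[1+k]*[1+n]C[1+k]≡[1+n]*nCk (suc n) (suc k) = begin
  suc (suc k) ℕ.* (suc (suc n) C suc (suc k))
    ≡⟨ cong (suc (suc k) ℕ.*_) (pascal (suc n) (suc k)) ⟨
  suc (suc k) ℕ.* (suc n C suc k ℕ.+ suc n C suc (suc k))
    ≡⟨ spread k (suc n C suc k) (suc n C suc (suc k)) ⟩
  suc k ℕ.* (suc n C suc k) ℕ.+ suc n C suc k ℕ.+ suc (suc k) ℕ.* (suc n C suc (suc k))
    ≡⟨ cong₂ (λ a b → a ℕ.+ suc n C suc k ℕ.+ b) ([1+k]*[1+n]C[1+k]≡[1+n]*nCk n k) ([1+k]*[1+n]C[1+k]≡[1+n]*nCk n (suc k)) ⟩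
  suc n ℕ.* (n C k) ℕ.+ suc n C suc k ℕ.+ suc n ℕ.* (n C suc k)
    ≡⟨ collect n (n C k) (n C suc k) (suc n C suc k) ⟩
  suc n ℕ.* (n C k ℕ.+ n C suc k) ℕ.+ suc n C suc k
    ≡⟨ cong (λ a → suc n ℕ.* a ℕ.+ suc n C suc k) (pascal n k) ⟩
  suc n ℕ.* (suc n C suc k) ℕ.+ suc n C suc k
    ≡⟨ +-comm (suc n ℕ.* (suc n C suc k)) _ ⟩
  suc (suc n) ℕ.* (suc n C suc k) ∎
  where
  open ≡-Reasoning
  pascal = nCk+nC[k+1]≡[n+1]C[k+1]
  spread : ∀ k x y → suc (suc k) ℕ.* (x ℕ.+ y) ≡ suc k ℕ.* x ℕ.+ x ℕ.+ suc (suc k) ℕ.* y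
  spread = ℕ-Solver.solve-∀
  collect : ∀ n x y z → suc n ℕ.* x ℕ.+ z ℕ.+ suc n ℕ.* y ≡ suc n ℕ.* (x ℕ.+ y) ℕ.+ z
  collect = ℕ-Solver.solve-∀

[m+n]Cm≡[m+n]Cn : ∀ m n → (m ℕ.+ n) C m ≡ (m ℕ.+ n) C n
[m+n]Cm≡[m+n]Cn m n = trans (nCk≡nC[n∸k] (m≤m+n m n)) (cong ((m ℕ.+ n) C_) (m+n∸m≡n m n))

m+n+2≡[1+m]+[1+n] : ∀ m n → m ℕ.+ n ℕ.+ 2 ≡ suc m ℕ.+ suc n
m+n+2≡[1+m]+[1+n] m n = trans (+-assoc m n 2) (trans (cong (m ℕ.+_) (+-comm n 2)) (+-suc m (suc n)))

den-comm : ∀ i j → den i j ≡ den j i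
den-comm i j = cong₂ ℕ._*_ (*-comm (suc i) (suc j)) (begin
  (i ℕ.+ j ℕ.+ 2) C suc i    ≡⟨ cong (_C suc i) (m+n+2≡[1+m]+[1+n] i j) ⟩
  (suc i ℕ.+ suc j) C suc i  ≡⟨ [m+n]Cm≡[m+n]Cn (suc i) (suc j) ⟩
  (suc i ℕ.+ suc j) C suc j  ≡⟨ cong (_C suc j) (+-comm (suc i) (suc j)) ⟩
  (suc j ℕ.+ suc i) C suc j  ≡⟨ cong (_C suc j) (m+n+2≡[1+m]+[1+n] j i) ⟨
  (j ℕ.+ i ℕ.+ 2) C suc j    ∎)
  where open ≡-Reasoning

den-suc-left : ∀ i j → suc i ℕ.* den (suc i) j ≡ suc (i ℕ.+ j ℕ.+ 2) ℕ.* den i j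
den-suc-left i j = begin
  suc i ℕ.* (suc (suc i) ℕ.* suc j ℕ.* (suc n C suc (suc i)))  ≡⟨ regroup (suc i) (suc j) (suc (suc i)) _ ⟩
  suc i ℕ.* suc j ℕ.* (suc (suc i) ℕ.* (suc n C suc (suc i)))  ≡⟨ cong (suc i ℕ.* suc j ℕ.*_) ([1+k]*[1+n]C[1+k]≡[1+n]*nCk n (suc i)) ⟩
  suc i ℕ.* suc j ℕ.* (suc n ℕ.* (n C suc i))                  ≡⟨ regroup (suc i) (suc j) (suc n) _ ⟨
  suc i ℕ.* (suc n ℕ.* suc j ℕ.* (n C suc i))                  ≡⟨ rotate (suc i) (suc n) (suc j) _ ⟩
  suc n ℕ.* (suc i ℕ.* suc j ℕ.* (n C suc i))                  ∎
  where
  open ≡-Reasoning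
  n = i ℕ.+ j ℕ.+ 2
  regroup : ∀ a b c x → a ℕ.* (c ℕ.* b ℕ.* x) ≡ a ℕ.* b ℕ.* (c ℕ.* x)
  regroup = ℕ-Solver.solve-∀
  rotate : ∀ a c b x → a ℕ.* (c ℕ.* b ℕ.* x) ≡ c ℕ.* (a ℕ.* b ℕ.* x)
  rotate = ℕ-Solver.solve-∀

den-suc-right : ∀ i j → suc j ℕ.* den i (suc j) ≡ suc (i ℕ.+ j ℕ.+ 2) ℕ.* den i j
den-suc-right i j = begin
  suc j ℕ.* den i (suc j)            ≡⟨ cong (suc j ℕ.*_) (den-comm i (suc j)) ⟩
  suc j ℕ.* den (suc j) i            ≡⟨ den-suc-left j i ⟩
  suc (j ℕ.+ i ℕ.+ 2) ℕ.* den j i    ≡⟨ cong₂ (λ m d → suc (m ℕ.+ 2) ℕ.* d) (+-comm j i) (den-comm j i) ⟩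
  suc (i ℕ.+ j ℕ.+ 2) ℕ.* den i j    ∎
  where open ≡-Reasoning

pos-*-≡ : ∀ m n p q → m ℕ.* n ≡ p ℕ.* q → + m ℤ.* + n ≡ + p ℤ.* + q
pos-*-≡ m n p q eq = trans (sym (ℤ.pos-* m n)) (trans (cong +_ eq) (ℤ.pos-* p q))

cancel-denominators : ∀ {P Q N D d e x y z : ℤ} .{{_ : ℤ.NonZero P}} .{{_ : ℤ.NonZero Q}} →
                      P ℤ.* d ≡ N ℤ.* D → Q ℤ.* e ≡ N ℤ.* D → x ℤ.* P ℤ.+ y ℤ.* Q ≡ z ℤ.* N →
                      (x ℤ.* e ℤ.+ y ℤ.* d) ℤ.* D ≡ z ℤ.* (d ℤ.* e)
cancel-denominators {P} {Q} {N} {D} {d} {e} {x} {y} {z} Pd≡ND Qe≡ND xP+yQ≡zN =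
  ℤ.*-cancelˡ-≡ (P ℤ.* Q) _ _ {{ℤ.i*j≢0 P Q}} (begin
    P ℤ.* Q ℤ.* ((x ℤ.* e ℤ.+ y ℤ.* d) ℤ.* D)
      ≡⟨ ℤ-Solver.solve (P ∷ Q ∷ D ∷ d ∷ e ∷ x ∷ y ∷ []) ⟩
    (x ℤ.* P ℤ.* (Q ℤ.* e) ℤ.+ y ℤ.* Q ℤ.* (P ℤ.* d)) ℤ.* D
      ≡⟨ cong₂ (λ a b → (x ℤ.* P ℤ.* a ℤ.+ y ℤ.* Q ℤ.* b) ℤ.* D) Qe≡ND Pd≡ND ⟩
    (x ℤ.* P ℤ.* (N ℤ.* D) ℤ.+ y ℤ.* Q ℤ.* (N ℤ.* D)) ℤ.* D
      ≡⟨ ℤ-Solver.solve (P ∷ Q ∷ N ∷ D ∷ x ∷ y ∷ []) ⟩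
    (x ℤ.* P ℤ.+ y ℤ.* Q) ℤ.* (N ℤ.* D ℤ.* D)
      ≡⟨ cong (ℤ._* (N ℤ.* D ℤ.* D)) xP+yQ≡zN ⟩
    z ℤ.* N ℤ.* (N ℤ.* D ℤ.* D)
      ≡⟨ ℤ-Solver.solve (N ∷ D ∷ z ∷ []) ⟩
    z ℤ.* (N ℤ.* D) ℤ.* (N ℤ.* D)
      ≡⟨ cong₂ (λ a b → z ℤ.* a ℤ.* b) Pd≡ND Qe≡ND ⟨
    z ℤ.* (P ℤ.* d) ℤ.* (Q ℤ.* e)
      ≡⟨ ℤ-Solver.solve (P ∷ Q ∷ d ∷ e ∷ z ∷ []) ⟩
    P ℤ.* Q ℤ.* (z ℤ.* (d ℤ.* e)) ∎)
  where open ≡-Reasoning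

numerator-identity : ∀ i j (s : ℤ) → (+ j ℤ.- + suc i) ℤ.* ℤ.- s ℤ.* + suc i ℤ.+ (+ suc j ℤ.- + i) ℤ.* ℤ.- s ℤ.* + suc j
                           ≡ ℤ.- ((+ j ℤ.- + i) ℤ.* s) ℤ.* + suc (i ℕ.+ j ℕ.+ 2)
numerator-identity i j = identity (+ i) (+ j)
  where
  identity : ∀ I J s → (J ℤ.- (+ 1 ℤ.+ I)) ℤ.* ℤ.- s ℤ.* (+ 1 ℤ.+ I) ℤ.+ ((+ 1 ℤ.+ J) ℤ.- I) ℤ.* ℤ.- s ℤ.* (+ 1 ℤ.+ J)
                       ≡ ℤ.- ((J ℤ.- I) ℤ.* s) ℤ.* (+ 1 ℤ.+ (I ℤ.+ J ℤ.+ + 2))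
  identity = ℤ-Solver.solve-∀

toℚᵘ-/ : ∀ n d .{{_ : NonZero d}} → toℚᵘ (n / d) ≃ n ℚᵘ./ d
toℚᵘ-/ n (suc d) = toℚᵘ-fromℚᵘ (mkℚᵘ n d)

neg-/ : ∀ n d .{{_ : NonZero d}} → - (n / d) ≡ (ℤ.- n) / d
neg-/ n d@(suc _) = toℚᵘ-injective (≃-trans (toℚᵘ-homo‿- (n / d)) (≃-trans (-‿cong (toℚᵘ-/ n d)) (≃-sym (toℚᵘ-/ (ℤ.- n) d))))

a/d+b/e≡c/f : ∀ a b c d e f .{{_ : NonZero d}} .{{_ : NonZero e}} .{{_ : NonZero f}} →
              (a ℤ.* + e ℤ.+ b ℤ.* + d) ℤ.* + f ≡ c ℤ.* (+ d ℤ.* + e) → a / d + b / e ≡ c / f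
a/d+b/e≡c/f a b c d@(suc _) e@(suc _) f@(suc _) cross = toℚᵘ-injective (begin
  toℚᵘ (a / d + b / e)             ≈⟨ toℚᵘ-homo-+ (a / d) (b / e) ⟩
  toℚᵘ (a / d) ℚᵘ.+ toℚᵘ (b / e)   ≈⟨ +-cong (toℚᵘ-/ a d) (toℚᵘ-/ b e) ⟩
  a ℚᵘ./ d ℚᵘ.+ b ℚᵘ./ e           ≈⟨ *≡* (trans cross (cong (c ℤ.*_) (sym (ℤ.pos-* d e)))) ⟩
  c ℚᵘ./ f                         ≈⟨ toℚᵘ-/ c f ⟨
  toℚᵘ (c / f)                     ∎)
  where open ≃-Reasoning

lemma2p8 : ∀ (i j : ℕ) → MC (suc i) j + MC i (suc j) ≡ - MC i j
lemma2p8 i j = begin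
  MC (suc i) j + MC i (suc j)  ≡⟨ a/d+b/e≡c/f a b (ℤ.- c) (den (suc i) j) (den i (suc j)) (den i j) cross ⟩
  (ℤ.- c) / den i j            ≡⟨ neg-/ c (den i j) ⟨
  - MC i j                     ∎
  where
  open ≡-Reasoning
  instance
    _ = den≢0 i j
    _ = den≢0 (suc i) j
    _ = den≢0 i (suc j)
  n = i ℕ.+ j ℕ.+ 2
  s = sgn (i ℕ.+ j)
  a = (+ j ℤ.- + suc i) ℤ.* sgn (suc i ℕ.+ j)
  b = (+ suc j ℤ.- + i) ℤ.* sgn (i ℕ.+ suc j)
  c = (+ j ℤ.- + i) ℤ.* s
  numerators : a ℤ.* + suc i ℤ.+ b ℤ.* + suc j ≡ ℤ.- c ℤ.* + suc n
  numerators rewrite +-suc i j = numerator-identity i j s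
  [1+i]*d≡N*D : + suc i ℤ.* + den (suc i) j ≡ + suc n ℤ.* + den i j
  [1+i]*d≡N*D = pos-*-≡ (suc i) (den (suc i) j) (suc n) (den i j) (den-suc-left i j)
  [1+j]*e≡N*D : + suc j ℤ.* + den i (suc j) ≡ + suc n ℤ.* + den i j
  [1+j]*e≡N*D = pos-*-≡ (suc j) (den i (suc j)) (suc n) (den i j) (den-suc-right i j)
  cross : (a ℤ.* + den i (suc j) ℤ.+ b ℤ.* + den (suc i) j) ℤ.* + den i j ≡ ℤ.- c ℤ.* (+ den (suc i) j ℤ.* + den i (suc j))
  cross = cancel-denominators {x = a} {y = b} {z = ℤ.- c} [1+i]*d≡N*D [1+j]*e≡N*D numerators
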